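{- Let $G=\bigoplus_{t=1}^r\mathbb{Z}_{k_t}$ be a finite abelian group and $d,m$ positive integers. For each $m$-composition ${\bf u}=(u_1,\ldots,u_m)$ over $G$ define ${\bf v}=\phi({\bf u})=(v_1,\ldots,v_m)$ by $v_j=u_1+\cdots+u_j$ (in $G$), $1\le j\le m$. Then $\phi$ restricts to a bijection from the set of locally $d$-Mullen $m$-compositions over $G$ onto the set of $d$-Carlitz weak $m$-compositions over $G$ whose first $d$ parts are nonzero.
   Context: Addition in $G$ is componentwise modulo $k_t$. A locally $d$-Mullen $m$-composition over $G$ is a sequence $(u_1,\ldots,u_m)$ of elements of $G$ such that $u_i+\cdots+u_j\neq{\bf 0}$ whenever $1\le i\le j\le m$ and $j-i+1\le d$. A $d$-Carlitz weak $m$-composition over $G$ is a sequence $(v_1,\ldots,v_m)$ of elements of $G$ with no repeated part among any $d+1$ consecutive parts, i.e. $v_i\neq v_{i'}$ whenever $1\le|i-i'|\le d$. "First $d$ parts nonzero" means $v_j\ne{\bf 0}$ for $1\le j\le\min(d,m)$. -}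

module Defs where

open import Data.Nat using (ℕ; zero; suc; _≤_; _<_; _∸_; NonZero)
import Data.Nat as ℕ
open import Data.Nat.DivMod using (_%_; m%n<n)
open import Data.Fin using (Fin; toℕ; fromℕ<)
open import Data.Product using (Σ; _×_; _,_)
open import Relation.Binary.PropositionalEquality using (_≡_)
open import Relation.Nullary using (¬_)

module Group (r : ℕ) (k : Fin r → ℕ) (pos : (t : Fin r) → NonZero (k t)) where

  G : Set
  G = (t : Fin r) → Fin (k t)

  addMod : (n : ℕ) → NonZero n → Fin n → Fin n → Fin n
  addMod n nz a b = fromℕ< (m%n<n (toℕ a ℕ.+ toℕ b) n {{nz}})

  _⊕_ : G → G → G
  (x ⊕ y) t = addMod (k t) (pos t) (x t) (y t)

  𝟎 : G
  𝟎 t = fromℕ< (m%n<n 0 (k t) {{pos t}})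

  _≈_ : G → G → Set
  x ≈ y = (t : Fin r) → x t ≡ y t

  -- an m-composition over G, indexed by positions 1..m (as ℕ; only 1 ≤ i ≤ m used)
  -- is represented as a function Fin m → G, position i ↦ index i-1.
  Comp : ℕ → Set
  Comp m = Fin m → G

  -- partial sum u_{i} + ... + u_{j} using 0-based indices i..j (as naturals),
  -- computed as the left fold over positions i, i+1, ..., j
  -- sumFrom u i len = u_i + u_{i+1} + ... + u_{i+len-1}  (0-based); 𝟎 if len = 0
  -- indices out of range are not used by the definitions below.
  sumFrom : {m : ℕ} → Comp m → ℕ → ℕ → G
  sumFrom u i zero = 𝟎
  sumFrom {m} u i (suc len) with ℕ._<?_ (i ℕ.+ len) m
  ... | Relation.Nullary.yes p = sumFrom u i len ⊕ u (fromℕ< p)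
  ... | Relation.Nullary.no _ = sumFrom u i len

  -- locally d-Mullen: u_i + ... + u_j ≠ 0 whenever 1 ≤ i ≤ j ≤ m, j - i + 1 ≤ d.
  -- With 0-based start i and length len = j - i + 1: 1 ≤ len ≤ d, i + len ≤ m.
  LocallyMullen : (d : ℕ) {m : ℕ} → Comp m → Set
  LocallyMullen d {m} u =
    (i len : ℕ) → 1 ≤ len → len ≤ d → i ℕ.+ len ≤ m → ¬ (sumFrom u i len ≈ 𝟎)

  Carlitz : (d : ℕ) {m : ℕ} → Comp m → Set
  Carlitz d {m} v =
    (i i' : Fin m) → toℕ i < toℕ i' → toℕ i' ∸ toℕ i ≤ d → ¬ (v i ≈ v i')

  FirstNonzero : (d : ℕ) {m : ℕ} → Comp m → Set
  FirstNonzero d {m} v = (j : Fin m) → toℕ j < d → ¬ (v j ≈ 𝟎)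

  φ : {m : ℕ} → Comp m → Comp m
  φ u j = sumFrom u 0 (suc (toℕ j))

  _≋_ : {m : ℕ} → Comp m → Comp m → Set
  _≋_ {m} u u' = (j : Fin m) → u j ≈ u' j

module Submission where

-- The segment sums of u are differences of its prefix sums P₀ = 𝟎, P₁, …, Pₘ, and φ u = (P₁, …, Pₘ).
-- Hence a segment u_{i+1} + ⋯ + u_j of length at most d vanishes iff Pᵢ = Pⱼ: for i ≥ 1 this is a
-- repetition within distance d in φ u, for i = 0 a zero among its first d parts. The inverse of φ
-- is the difference map Δ v = (v₁, v₂ − v₁, …, vₘ − vₘ₋₁); only the group laws of G are used.

open import Defs
open import Data.Nat using (ℕ; NonZero; _≤_)
open import Data.Fin using (Fin)
open import Data.Product using (Σ; _×_)

open import Algebra.Bundles using () renaming (Group to GroupBundle)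
open import Algebra.Structures using (IsGroup)
import Algebra.Properties.Group as GroupProperties
open import Data.Nat using (zero; suc; _+_; _∸_; _<_; _%_; s≤s; z≤n; s<s⁻¹; >-nonZero⁻¹; _<?_)
open import Data.Nat.Properties
  using (+-assoc; +-comm; +-identityʳ; +-suc; <⇒≤; ≤-trans; m≤m+n; m<m+n; m∸n+n≡m; m+n∸m≡n; m+[n∸m]≡n; m<n⇒0<n∸m)
open import Data.Nat.DivMod using (m%n<n; %-distribˡ-+; m%n%n≡m%n; m<n⇒m%n≡m; n%n≡0)
open import Data.Fin using (toℕ; fromℕ<; inject₁) renaming (zero to fzero; suc to fsuc)
open import Data.Fin.Properties using (toℕ-injective; toℕ-fromℕ<; fromℕ<-toℕ; toℕ-inject₁; toℕ<n)
open import Data.Product using (_,_)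
open import Function.Bundles using (_⇔_; mk⇔; Equivalence)
open import Function.Base using (_∘_)
open import Level using (0ℓ)
open import Relation.Nullary using (yes; no; ¬_; contradiction)
open import Relation.Binary.PropositionalEquality as ≡ using (_≡_; cong; cong₂; subst; subst₂)
import Relation.Binary.Reasoning.Setoid as SetoidReasoning

[m%n+o]%n≡[m+o]%n : ∀ m o n .{{_ : NonZero n}} → (m % n + o) % n ≡ (m + o) % n
[m%n+o]%n≡[m+o]%n m o n = begin
  (m % n + o) % n           ≡⟨ %-distribˡ-+ (m % n) o n ⟩
  (m % n % n + o % n) % n   ≡⟨ cong (λ x → (x + o % n) % n) (m%n%n≡m%n m n) ⟩
  (m % n + o % n) % n       ≡⟨ %-distribˡ-+ m o n ⟨
  (m + o) % n               ∎
  where open ≡.≡-Reasoning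

[m+o%n]%n≡[m+o]%n : ∀ m o n .{{_ : NonZero n}} → (m + o % n) % n ≡ (m + o) % n
[m+o%n]%n≡[m+o]%n m o n = begin
  (m + o % n) % n   ≡⟨ cong (_% n) (+-comm m (o % n)) ⟩
  (o % n + m) % n   ≡⟨ [m%n+o]%n≡[m+o]%n o m n ⟩
  (o + m) % n       ≡⟨ cong (_% n) (+-comm o m) ⟩
  (m + o) % n       ∎
  where open ≡.≡-Reasoning

fromℕ<-inject₁ : ∀ {n m} .(n<m : n < m) .(n<1+m : n < suc m) → fromℕ< n<1+m ≡ inject₁ (fromℕ< n<m)
fromℕ<-inject₁ n<m n<1+m = toℕ-injective (≡.trans (toℕ-fromℕ< n<1+m)
  (≡.sym (≡.trans (toℕ-inject₁ (fromℕ< n<m)) (toℕ-fromℕ< n<m))))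

module Properties (r : ℕ) (k : Fin r → ℕ) (pos : (t : Fin r) → NonZero (k t)) where
  open Group r k pos

  module ℤ/n (n : ℕ) (nz : NonZero n) where
    private instance
      nonZero : NonZero n
      nonZero = nz

    zeroMod : Fin n
    zeroMod = fromℕ< (m%n<n 0 n)

    negMod : Fin n → Fin n
    negMod a = fromℕ< (m%n<n (n ∸ toℕ a) n)

    _+ₙ_ : Fin n → Fin n → Fin n
    _+ₙ_ = addMod n nz

    toℕ-+ₙ : ∀ a b → toℕ (a +ₙ b) ≡ (toℕ a + toℕ b) % n
    toℕ-+ₙ a b = toℕ-fromℕ< _

    +ₙ-assoc : ∀ a b c → (a +ₙ b) +ₙ c ≡ a +ₙ (b +ₙ c)
    +ₙ-assoc a b c = toℕ-injective (begin
      toℕ ((a +ₙ b) +ₙ c)                   ≡⟨ toℕ-+ₙ (a +ₙ b) c ⟩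
      (toℕ (a +ₙ b) + toℕ c) % n            ≡⟨ cong (λ x → (x + toℕ c) % n) (toℕ-+ₙ a b) ⟩
      ((toℕ a + toℕ b) % n + toℕ c) % n     ≡⟨ [m%n+o]%n≡[m+o]%n (toℕ a + toℕ b) (toℕ c) n ⟩
      (toℕ a + toℕ b + toℕ c) % n           ≡⟨ cong (_% n) (+-assoc (toℕ a) (toℕ b) (toℕ c)) ⟩
      (toℕ a + (toℕ b + toℕ c)) % n         ≡⟨ [m+o%n]%n≡[m+o]%n (toℕ a) (toℕ b + toℕ c) n ⟨
      (toℕ a + (toℕ b + toℕ c) % n) % n     ≡⟨ cong (λ x → (toℕ a + x) % n) (toℕ-+ₙ b c) ⟨
      (toℕ a + toℕ (b +ₙ c)) % n            ≡⟨ toℕ-+ₙ a (b +ₙ c) ⟨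
      toℕ (a +ₙ (b +ₙ c))                   ∎)
      where open ≡.≡-Reasoning

    +ₙ-comm : ∀ a b → a +ₙ b ≡ b +ₙ a
    +ₙ-comm a b = toℕ-injective (begin
      toℕ (a +ₙ b)          ≡⟨ toℕ-+ₙ a b ⟩
      (toℕ a + toℕ b) % n   ≡⟨ cong (_% n) (+-comm (toℕ a) (toℕ b)) ⟩
      (toℕ b + toℕ a) % n   ≡⟨ toℕ-+ₙ b a ⟨
      toℕ (b +ₙ a)          ∎)
      where open ≡.≡-Reasoning

    toℕ-zeroMod : toℕ zeroMod ≡ 0
    toℕ-zeroMod = ≡.trans (toℕ-fromℕ< _) (m<n⇒m%n≡m (>-nonZero⁻¹ n))

    +ₙ-identityˡ : ∀ a → zeroMod +ₙ a ≡ a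
    +ₙ-identityˡ a = toℕ-injective (begin
      toℕ (zeroMod +ₙ a)            ≡⟨ toℕ-+ₙ zeroMod a ⟩
      (toℕ zeroMod + toℕ a) % n     ≡⟨ cong (λ x → (x + toℕ a) % n) toℕ-zeroMod ⟩
      toℕ a % n                     ≡⟨ m<n⇒m%n≡m (toℕ<n a) ⟩
      toℕ a                         ∎)
      where open ≡.≡-Reasoning

    +ₙ-inverseˡ : ∀ a → negMod a +ₙ a ≡ zeroMod
    +ₙ-inverseˡ a = toℕ-injective (begin
      toℕ (negMod a +ₙ a)                  ≡⟨ toℕ-+ₙ (negMod a) a ⟩
      (toℕ (negMod a) + toℕ a) % n         ≡⟨ cong (λ x → (x + toℕ a) % n) (toℕ-fromℕ< _) ⟩
      ((n ∸ toℕ a) % n + toℕ a) % n        ≡⟨ [m%n+o]%n≡[m+o]%n (n ∸ toℕ a) (toℕ a) n ⟩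
      (n ∸ toℕ a + toℕ a) % n              ≡⟨ cong (_% n) (m∸n+n≡m (<⇒≤ (toℕ<n a))) ⟩
      n % n                                ≡⟨ n%n≡0 n ⟩
      0                                    ≡⟨ toℕ-zeroMod ⟨
      toℕ zeroMod                          ∎)
      where open ≡.≡-Reasoning

  open ℤ/n using (negMod; +ₙ-assoc; +ₙ-comm; +ₙ-identityˡ; +ₙ-inverseˡ)

  ⊖_ : G → G
  (⊖ x) t = negMod (k t) (pos t) (x t)

  ⊕-isGroup : IsGroup _≈_ _⊕_ 𝟎 ⊖_
  ⊕-isGroup = record
    { isMonoid = record
      { isSemigroup = record
        { isMagma = record
          { isEquivalence = record
            { refl = λ t → ≡.refl
            ; sym = λ x≈y t → ≡.sym (x≈y t)
            ; trans = λ x≈y y≈z t → ≡.trans (x≈y t) (y≈z t)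
            }
          ; ∙-cong = λ x≈x' y≈y' t → cong₂ (addMod (k t) (pos t)) (x≈x' t) (y≈y' t)
          }
        ; assoc = λ x y z t → +ₙ-assoc (k t) (pos t) (x t) (y t) (z t)
        }
      ; identity = (λ x t → +ₙ-identityˡ (k t) (pos t) (x t))
                 , (λ x t → ≡.trans (+ₙ-comm (k t) (pos t) (x t) _) (+ₙ-identityˡ (k t) (pos t) (x t)))
      }
    ; inverse = (λ x t → +ₙ-inverseˡ (k t) (pos t) (x t))
              , (λ x t → ≡.trans (+ₙ-comm (k t) (pos t) (x t) _) (+ₙ-inverseˡ (k t) (pos t) (x t)))
    ; ⁻¹-cong = λ x≈y t → cong (negMod (k t) (pos t)) (x≈y t)
    }

  ⊕-group : GroupBundle 0ℓ 0ℓ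
  ⊕-group = record { isGroup = ⊕-isGroup }

  open GroupBundle ⊕-group
    using (setoid; _\\_; assoc; identityˡ; identityʳ; ∙-congˡ; ∙-congʳ)
    renaming (sym to ≈-sym; trans to ≈-trans; reflexive to ≈-reflexive)
  open GroupProperties ⊕-group using (∙-cancelˡ; \\-leftDividesˡ; \\-leftDividesʳ; \\-cong₂)
  open SetoidReasoning setoid

  prefixSum : {m : ℕ} → Comp m → ℕ → G
  prefixSum u = sumFrom u 0

  sumFrom-suc : ∀ {m} (u : Comp m) i len (i+len<m : i + len < m) →
                sumFrom u i (suc len) ≡ (sumFrom u i len ⊕ u (fromℕ< i+len<m))
  sumFrom-suc {m} u i len i+len<m with i + len <? m
  ... | yes _ = ≡.refl
  ... | no i+len≮m = contradiction i+len<m i+len≮m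

  prefixSum-+ : ∀ {m} (u : Comp m) i len → i + len ≤ m →
                prefixSum u (i + len) ≈ (prefixSum u i ⊕ sumFrom u i len)
  prefixSum-+ u i zero _ = begin
    prefixSum u (i + 0)   ≡⟨ cong (prefixSum u) (+-identityʳ i) ⟩
    prefixSum u i         ≈⟨ identityʳ (prefixSum u i) ⟨
    prefixSum u i ⊕ 𝟎     ∎
  prefixSum-+ {m} u i (suc len) i+len<m′ = begin
    prefixSum u (i + suc len)                                ≡⟨ cong (prefixSum u) (+-suc i len) ⟩
    prefixSum u (suc (i + len))                              ≡⟨ sumFrom-suc u 0 (i + len) i+len<m ⟩
    prefixSum u (i + len) ⊕ u (fromℕ< i+len<m)               ≈⟨ ∙-congʳ (prefixSum-+ u i len (<⇒≤ i+len<m)) ⟩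
    (prefixSum u i ⊕ sumFrom u i len) ⊕ u (fromℕ< i+len<m)   ≈⟨ assoc _ _ _ ⟩
    prefixSum u i ⊕ (sumFrom u i len ⊕ u (fromℕ< i+len<m))   ≡⟨ cong (prefixSum u i ⊕_) (sumFrom-suc u i len i+len<m) ⟨
    prefixSum u i ⊕ sumFrom u i (suc len)                    ∎
    where
      i+len<m : i + len < m
      i+len<m = subst (_≤ m) (+-suc i len) i+len<m′

  sumFrom≈𝟎⇔prefixSum≈ : ∀ {m} (u : Comp m) i len → i + len ≤ m →
                          sumFrom u i len ≈ 𝟎 ⇔ prefixSum u (i + len) ≈ prefixSum u i
  sumFrom≈𝟎⇔prefixSum≈ u i len i+len≤m = mk⇔
    (λ s≈𝟎 → begin
      prefixSum u (i + len)              ≈⟨ split ⟩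
      prefixSum u i ⊕ sumFrom u i len    ≈⟨ ∙-congˡ s≈𝟎 ⟩
      prefixSum u i ⊕ 𝟎                  ≈⟨ identityʳ (prefixSum u i) ⟩
      prefixSum u i                      ∎)
    (λ prefix≈ → ∙-cancelˡ (prefixSum u i) _ _ (begin
      prefixSum u i ⊕ sumFrom u i len    ≈⟨ split ⟨
      prefixSum u (i + len)              ≈⟨ prefix≈ ⟩
      prefixSum u i                      ≈⟨ identityʳ (prefixSum u i) ⟨
      prefixSum u i ⊕ 𝟎                  ∎))
    where split = prefixSum-+ u i len i+len≤m

  φ-fromℕ< : ∀ {m} (u : Comp m) {n} (n<m : n < m) → φ u (fromℕ< n<m) ≡ prefixSum u (suc n)
  φ-fromℕ< u n<m = cong (λ n → prefixSum u (suc n)) (toℕ-fromℕ< n<m)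

  φ-suc : ∀ {m} (u : Comp m) j → φ u j ≈ (prefixSum u (toℕ j) ⊕ u j)
  φ-suc u j = begin
    φ u j                                       ≡⟨ sumFrom-suc u 0 (toℕ j) (toℕ<n j) ⟩
    prefixSum u (toℕ j) ⊕ u (fromℕ< (toℕ<n j))  ≡⟨ cong (λ i → prefixSum u (toℕ j) ⊕ u i) (fromℕ<-toℕ j (toℕ<n j)) ⟩
    prefixSum u (toℕ j) ⊕ u j                   ∎

  carlitz-prefixSum : ∀ {d m} {u : Comp m} → Carlitz d (φ u) →
                      ∀ {i j} (i<m : i < m) (j<m : j < m) → i < j → j ∸ i ≤ d →
                      ¬ (prefixSum u (suc i) ≈ prefixSum u (suc j))
  carlitz-prefixSum {d} {u = u} carlitz {i} {j} i<m j<m i<j j∸i≤d prefix≈ =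
    carlitz (fromℕ< i<m) (fromℕ< j<m)
      (subst₂ _<_ (≡.sym (toℕ-fromℕ< i<m)) (≡.sym (toℕ-fromℕ< j<m)) i<j)
      (subst₂ (λ a b → b ∸ a ≤ d) (≡.sym (toℕ-fromℕ< i<m)) (≡.sym (toℕ-fromℕ< j<m)) j∸i≤d)
      (begin
        φ u (fromℕ< i<m)     ≡⟨ φ-fromℕ< u i<m ⟩
        prefixSum u (suc i)  ≈⟨ prefix≈ ⟩
        prefixSum u (suc j)  ≡⟨ φ-fromℕ< u j<m ⟨
        φ u (fromℕ< j<m)     ∎)

  locallyMullen⇒carlitz : ∀ {d m} {u : Comp m} → LocallyMullen d u → Carlitz d (φ u)
  locallyMullen⇒carlitz {m = m} {u} mullen i j i<j j∸i≤d φi≈φj =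
    mullen (suc (toℕ i)) (toℕ j ∸ toℕ i) (m<n⇒0<n∸m i<j) j∸i≤d bound
      (Equivalence.from (sumFrom≈𝟎⇔prefixSum≈ u (suc (toℕ i)) _ bound) (begin
        prefixSum u (suc (toℕ i) + (toℕ j ∸ toℕ i))  ≡⟨ cong (λ n → prefixSum u (suc n)) i+[j∸i]≡j ⟩
        φ u j                                        ≈⟨ φi≈φj ⟨
        φ u i                                        ∎))
    where
      i+[j∸i]≡j : toℕ i + (toℕ j ∸ toℕ i) ≡ toℕ j
      i+[j∸i]≡j = m+[n∸m]≡n (<⇒≤ i<j)
      bound : suc (toℕ i) + (toℕ j ∸ toℕ i) ≤ m
      bound = subst (λ n → suc n ≤ m) (≡.sym i+[j∸i]≡j) (toℕ<n j)

  locallyMullen⇒firstNonzero : ∀ {d m} {u : Comp m} → LocallyMullen d u → FirstNonzero d (φ u)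
  locallyMullen⇒firstNonzero mullen j j<d = mullen 0 (suc (toℕ j)) (s≤s z≤n) j<d (toℕ<n j)

  carlitz×firstNonzero⇒locallyMullen : ∀ {d m} {u : Comp m} →
    Carlitz d (φ u) → FirstNonzero d (φ u) → LocallyMullen d u
  carlitz×firstNonzero⇒locallyMullen {d} {m} {u} carlitz nonzero i (suc l) _ l<d i+l<m s≈𝟎 =
    distinctPrefixSums i i+l<m (Equivalence.to (sumFrom≈𝟎⇔prefixSum≈ u i (suc l) i+l<m) s≈𝟎)
    where
      distinctPrefixSums : ∀ i → i + suc l ≤ m → ¬ (prefixSum u (i + suc l) ≈ prefixSum u i)
      distinctPrefixSums zero l<m prefix≈ =
        nonzero (fromℕ< l<m) (subst (_< d) (≡.sym (toℕ-fromℕ< l<m)) l<d)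
          (≈-trans (≈-reflexive (φ-fromℕ< u l<m)) prefix≈)
      distinctPrefixSums (suc i) i+l<m prefix≈ =
        carlitz-prefixSum carlitz (≤-trans (s≤s (m≤m+n i (suc l))) i+l<m) i+l<m
          (m<m+n i (s≤s z≤n)) (subst (_≤ d) (≡.sym (m+n∸m≡n i (suc l))) l<d) (≈-sym prefix≈)

  Δ : ∀ {m} → Comp m → Comp m
  Δ v fzero    = v fzero
  Δ v (fsuc j) = v (inject₁ j) \\ v (fsuc j)

  Δ-cong : ∀ {m} {v w : Comp m} → v ≋ w → Δ v ≋ Δ w
  Δ-cong v≋w fzero    = v≋w fzero
  Δ-cong v≋w (fsuc j) = \\-cong₂ (v≋w (inject₁ j)) (v≋w (fsuc j))

  Δ-φ : ∀ {m} (u : Comp m) → Δ (φ u) ≋ u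
  Δ-φ u fzero = begin
    φ u fzero      ≈⟨ φ-suc u fzero ⟩
    𝟎 ⊕ u fzero    ≈⟨ identityˡ (u fzero) ⟩
    u fzero        ∎
  Δ-φ u (fsuc j) = begin
    φ u (inject₁ j) \\ φ u (fsuc j)
      ≈⟨ ∙-congˡ (φ-suc u (fsuc j)) ⟩
    φ u (inject₁ j) \\ (prefixSum u (suc (toℕ j)) ⊕ u (fsuc j))
      ≡⟨ cong (λ n → φ u (inject₁ j) \\ (prefixSum u (suc n) ⊕ u (fsuc j))) (toℕ-inject₁ j) ⟨
    φ u (inject₁ j) \\ (φ u (inject₁ j) ⊕ u (fsuc j))
      ≈⟨ \\-leftDividesʳ (φ u (inject₁ j)) (u (fsuc j)) ⟩
    u (fsuc j)
      ∎

  prefixSum-Δ : ∀ {m} (v : Comp m) n (n<m : n < m) → prefixSum (Δ v) (suc n) ≈ v (fromℕ< n<m)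
  prefixSum-Δ {suc m} v zero n<m = begin
    prefixSum (Δ v) 1   ≡⟨ sumFrom-suc (Δ v) 0 0 n<m ⟩
    𝟎 ⊕ v fzero         ≈⟨ identityˡ (v fzero) ⟩
    v fzero             ∎
  prefixSum-Δ {suc m} v (suc n) 1+n<1+m = begin
    prefixSum (Δ v) (suc (suc n))
      ≡⟨ sumFrom-suc (Δ v) 0 (suc n) 1+n<1+m ⟩
    prefixSum (Δ v) (suc n) ⊕ (v (inject₁ i) \\ v (fsuc i))
      ≈⟨ ∙-congʳ (prefixSum-Δ v n (<⇒≤ 1+n<1+m)) ⟩
    v (fromℕ< (<⇒≤ 1+n<1+m)) ⊕ (v (inject₁ i) \\ v (fsuc i))
      ≡⟨ cong (λ j → v j ⊕ (v (inject₁ i) \\ v (fsuc i))) (fromℕ<-inject₁ n<m (<⇒≤ 1+n<1+m)) ⟩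
    v (inject₁ i) ⊕ (v (inject₁ i) \\ v (fsuc i))
      ≈⟨ \\-leftDividesˡ (v (inject₁ i)) (v (fsuc i)) ⟩
    v (fsuc i)
      ∎
    where
      n<m : n < m
      n<m = s<s⁻¹ 1+n<1+m
      i : Fin m
      i = fromℕ< n<m

  φ-Δ : ∀ {m} (v : Comp m) → φ (Δ v) ≋ v
  φ-Δ v j = begin
    φ (Δ v) j               ≈⟨ prefixSum-Δ v (toℕ j) (toℕ<n j) ⟩
    v (fromℕ< (toℕ<n j))    ≡⟨ cong v (fromℕ<-toℕ j (toℕ<n j)) ⟩
    v j                     ∎

  φ-injective : ∀ {m} {u u' : Comp m} → φ u ≋ φ u' → u ≋ u'
  φ-injective {u = u} {u'} φu≋φu' j = begin
    u j           ≈⟨ Δ-φ u j ⟨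
    Δ (φ u) j     ≈⟨ Δ-cong φu≋φu' j ⟩
    Δ (φ u') j    ≈⟨ Δ-φ u' j ⟩
    u' j          ∎

  carlitz-resp-≋ : ∀ {d m} {v w : Comp m} → v ≋ w → Carlitz d v → Carlitz d w
  carlitz-resp-≋ v≋w carlitz i j i<j j∸i≤d wi≈wj =
    carlitz i j i<j j∸i≤d (≈-trans (v≋w i) (≈-trans wi≈wj (≈-sym (v≋w j))))

  firstNonzero-resp-≋ : ∀ {d m} {v w : Comp m} → v ≋ w → FirstNonzero d v → FirstNonzero d w
  firstNonzero-resp-≋ v≋w nonzero j j<d wj≈𝟎 = nonzero j j<d (≈-trans (v≋w j) wj≈𝟎)

-- φ is injective on all compositions.
proposition5 : (r : ℕ) (k : Fin r → ℕ) (pos : (t : Fin r) → NonZero (k t))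
    → (d m : ℕ) → 1 ≤ d → 1 ≤ m
    → let open Group r k pos in
      ((u : Comp m) → LocallyMullen d u → Carlitz d (φ u) × FirstNonzero d (φ u))
      × ((u u' : Comp m) → LocallyMullen d u → LocallyMullen d u' → φ u ≋ φ u' → u ≋ u')
      × ((v : Comp m) → Carlitz d v → FirstNonzero d v
           → Σ (Comp m) (λ u → LocallyMullen d u × φ u ≋ v))
proposition5 r k pos d m _ _ =
    (λ u mullen → locallyMullen⇒carlitz mullen , locallyMullen⇒firstNonzero mullen)
  , (λ u u' _ _ → φ-injective)
  , λ v carlitz nonzero → Δ v
      , carlitz×firstNonzero⇒locallyMullen
          (carlitz-resp-≋ (≈-sym ∘ φ-Δ v) carlitz) (firstNonzero-resp-≋ (≈-sym ∘ φ-Δ v) nonzero)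
      , φ-Δ v
  where
    open Properties r k pos
    open GroupBundle ⊕-group using () renaming (sym to ≈-sym)
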